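{- Let $\mathit{nt}$ be the partial function defined on exactly those pairs $(\langle\chi,\vec a\rangle,\check\phi)$ (a loop and a quantifier-free formula over $\vec x$) for which \[ \check\phi(\vec x)\land\chi(\vec x)\implies\chi(\vec a(\vec x)) \] is valid, by $\mathit{nt}(\langle\chi,\vec a\rangle,\check\phi):=\chi$. Then $\mathit{nt}$ is a conditional non-termination technique; i.e., for every such pair and every $\vec x\in\mathbb Z^d$, if $\vec x$ is a witness of non-termination for $\langle\check\phi,\vec a\rangle$ and $\chi(\vec x)$ holds, then $\vec x$ is a witness of non-termination for $\langle\chi,\vec a\rangle$.
   Context: Fix $d\ge 1$ and integer variables $\vec x=(x_1,\dots,x_d)$. A loop $\langle\chi,\vec a\rangle$ consists of a quantifier-free formula $\chi$ over atoms $p>0$ ($p$ an arithmetic expression over $\vec x$, integer semantics) and a map $\vec a:\mathbb Z^d\to\mathbb Z^d$ given by expressions over $\vec x$; $\vec a^m$ is $m$-fold application ($\vec a^0=\mathrm{id}$). A vector $\vec x\in\mathbb Z^d$ is a witness of non-termination for $\langle\chi,\vec a\rangle$ if $\chi(\vec a^m(\vec x))$ holds for all $m\in\mathbb N$. A conditional non-termination technique is a partial function $\mathit{nt}$ mapping pairs (loop $\langle\chi,\vec a\rangle$, quantifier-free formula $\check\phi$ over $\vec x$) to quantifier-free formulas over $\vec x$ such that for all pairs in its domain and all $\vec x\in\mathbb Z^d$: if $\vec x$ is a witness of non-termination for $\langle\check\phi,\vec a\rangle$ and $\mathit{nt}(\langle\chi,\vec a\rangle,\check\phi)(\vec x)$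 holds, then $\vec x$ is a witness of non-termination for $\langle\chi,\vec a\rangle$. Validity means truth for all integer values of the free variables. -}

module Defs where

open import Data.Nat using (ℕ; zero; suc)
open import Data.Integer using (ℤ; _+_; _*_; -_; _>_; +_)
open import Data.Fin using (Fin)
open import Data.Product using (_×_)
open import Data.Sum using (_⊎_)
open import Data.Empty using (⊥)
open import Data.Unit using (⊤)
open import Relation.Nullary using (¬_)

Vecℤ : ℕ → Set
Vecℤ d = Fin d → ℤ

data Expr (d : ℕ) : Set where
  var  : Fin d → Expr d
  const : ℤ → Expr d
  _⊕_  : Expr d → Expr d → Expr d
  _⊗_  : Expr d → Expr d → Expr d
  neg  : Expr d → Expr d

evalE : ∀ {d} → Expr d → Vecℤ d → ℤ
evalE (var i) x = x i
evalE (const c) x = c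
evalE (e ⊕ f) x = evalE e x + evalE f x
evalE (e ⊗ f) x = evalE e x * evalE f x
evalE (neg e) x = - evalE e x

data Formula (d : ℕ) : Set where
  tt ff : Formula d
  pos   : Expr d → Formula d
  _∧ᶠ_ _∨ᶠ_ : Formula d → Formula d → Formula d
  ¬ᶠ_   : Formula d → Formula d

⟦_⟧ : ∀ {d} → Formula d → Vecℤ d → Set
⟦ tt ⟧ x = ⊤
⟦ ff ⟧ x = ⊥
⟦ pos p ⟧ x = evalE p x > + 0
⟦ φ ∧ᶠ ψ ⟧ x = ⟦ φ ⟧ x × ⟦ ψ ⟧ x
⟦ φ ∨ᶠ ψ ⟧ x = ⟦ φ ⟧ x ⊎ ⟦ ψ ⟧ x
⟦ ¬ᶠ φ ⟧ x = ¬ ⟦ φ ⟧ x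

Update : ℕ → Set
Update d = Fin d → Expr d

applyU : ∀ {d} → Update d → Vecℤ d → Vecℤ d
applyU a x i = evalE (a i) x

iter : ∀ {d} → Update d → ℕ → Vecℤ d → Vecℤ d
iter a zero x = x
iter a (suc m) x = applyU a (iter a m x)

record Loop (d : ℕ) : Set where
  constructor ⟨_,_⟩
  field
    guard  : Formula d
    update : Update d

WitnessNT : ∀ {d} → Loop d → Vecℤ d → Set
WitnessNT L x = ∀ (m : ℕ) → ⟦ Loop.guard L ⟧ (iter (Loop.update L) m x)

Valid : ∀ {d} → (Vecℤ d → Set) → Set
Valid {d} P = ∀ (x : Vecℤ d) → P x

-- A conditional non-termination technique: partial function given by its domain
-- predicate Dom and its value on the domain.
IsCondNTTechnique : ∀ {d} →
  (Dom : Loop d → Formula d → Set) →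
  ((L : Loop d) → (φ : Formula d) → Dom L φ → Formula d) → Set
IsCondNTTechnique {d} Dom nt =
  ∀ (L : Loop d) (φ : Formula d) (h : Dom L φ) (x : Vecℤ d) →
    WitnessNT ⟨ φ , Loop.update L ⟩ x → ⟦ nt L φ h ⟧ x → WitnessNT L x

Dom16 : ∀ {d} → Loop d → Formula d → Set
Dom16 ⟨ χ , a ⟩ φ = Valid (λ x → ⟦ φ ⟧ x × ⟦ χ ⟧ x → ⟦ χ ⟧ (applyU a x))

nt16 : ∀ {d} → (L : Loop d) → (φ : Formula d) → Dom16 L φ → Formula d
nt16 L φ _ = Loop.guard L

{-# OPTIONS --safe #-}
module Submission where

open import Data.Nat using (ℕ; _≥_; zero; suc)
open import Data.Product using (_×_; _,_)
open import Defs

iter-preserves : ∀ {d} (a : Update d) (P Q : Vecℤ d → Set) →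
  (∀ y → P y × Q y → Q (applyU a y)) →
  ∀ {x} → (∀ m → P (iter a m x)) → Q x → ∀ m → Q (iter a m x)
iter-preserves a P Q step along Qx zero = Qx
iter-preserves a P Q step along Qx (suc m) =
  step _ (along m , iter-preserves a P Q step along Qx m)

theorem16 : ∀ (d : ℕ) → d ≥ 1 → IsCondNTTechnique {d} Dom16 nt16
theorem16 d _ ⟨ χ , a ⟩ φ valid x =
  iter-preserves a ⟦ φ ⟧ ⟦ χ ⟧ valid
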